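{- Let $\mathbf u\in\{0,1\}^{\mathbb N}$ be an infinite word whose language is closed under all elements of $H=\{\mathrm{id},R,E,ER\}$. Then $\mathbf u$ is $H$-rich if and only if $S(\mathbf u)$ is $R$-rich. Likewise, $\mathbf u$ is almost $H$-rich if and only if $S(\mathbf u)$ is almost $R$-rich.
   Context: Alphabet $\{0,1\}$. For an infinite word $\mathbf u$, $\mathcal L(\mathbf u)$ denotes its set of finite factors (including the empty word $\varepsilon$). $R$ is the reversal antimorphism $R(w_0\cdots w_n)=w_n\cdots w_0$; $E$ is the antimorphism $E(w_0\cdots w_n)=\overline{w_n}\cdots\overline{w_0}$ where $\overline0=1,\overline1=0$; $ER=RE$ is the morphism exchanging the letters. $\mathbf u$ is closed under a map $\mu$ if $\mu(w)\in\mathcal L(\mathbf u)$ for every $w\in\mathcal L(\mathbf u)$. A word $p$ is an $R$-palindrome (resp. $E$-palindrome) if $R(p)=p$ (resp. $E(p)=p$). For a finite word $w$: $\mathrm{Pal}^R(w)$ is the set of $R$-palindromic factors of $w$ including $\varepsilon$, and $D^R(w)=|w|+1-\#\mathrm{Pal}^R(w)$; $\mathrm{Pal}^H(w)$ is the set of orbits $[p]=\{\mu(p):\mu\in H\}$ of factors $p$ of $w$ (including $\varepsilon$) that are $R$-palindromes or $E$-palindromes, and $D^H(w)=|w|+1-\#\mathrm{Pal}^H(w)$. For an infinite word, $D^X(\mathbf u)=\sup\{D^X(w):w\in\mathcal L(\mathbf u)\}$ ($X\in\{R,H\}$); $\mathbf u$ is $X$-rich if $D^X(\mathbf u)=0$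 and almost $X$-rich if $D^X(\mathbf u)<\infty$. The map $S$ is defined on infinite binary words by $S(u_0u_1u_2\cdots)=v_1v_2\cdots$ with $v_i=(u_{i-1}+u_i)\bmod 2$ for $i\ge1$. -}

module Defs where

open import Data.Bool using (Bool; true; false; not; _∨_; _xor_; if_then_else_)
import Data.Bool as Bool
open import Data.Nat using (ℕ; zero; suc; _+_; _∸_; _≤_)
open import Data.List using (List; []; _∷_; length; reverse; map; filter; deduplicateᵇ; concatMap; inits; tails)
open import Data.List.Properties using (≡-dec)
open import Data.Product using (∃; Σ; _×_)
open import Relation.Binary.PropositionalEquality using (_≡_)
open import Relation.Nullary.Decidable using (⌊_⌋)

-- Finite words over {0,1}; we encode 0 as false, 1 as true.
Word : Set
Word = List Bool

InfWord : Set
InfWord = ℕ → Bool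

_==_ : Word → Word → Bool
v == w = ⌊ ≡-dec Bool._≟_ v w ⌋

Rev : Word → Word
Rev = reverse

Ant : Word → Word
Ant w = reverse (map not w)

Exch : Word → Word
Exch = map not

data HElem : Set where
  hid hR hE hER : HElem

act : HElem → Word → Word
act hid w = w
act hR  w = Rev w
act hE  w = Ant w
act hER w = Exch w

window : InfWord → ℕ → ℕ → Word
window u i zero    = []
window u i (suc n) = u i ∷ window u (suc i) n

_∈L_ : Word → InfWord → Set
w ∈L u = ∃ λ i → window u i (length w) ≡ w

ClosedUnder : (Word → Word) → InfWord → Set
ClosedUnder μ u = ∀ w → w ∈L u → μ w ∈L u

ClosedUnderH : InfWord → Set
ClosedUnderH u = ∀ (h : HElem) → ClosedUnder (act h) u

factorsList : Word → List Word
factorsList w = concatMap inits (tails w)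

isRPal : Word → Bool
isRPal p = Rev p == p

isEPal : Word → Bool
isEPal p = Ant p == p

-- Pal^R(w): distinct R-palindromic factors (including ε)
PalR : Word → List Word
PalR w = deduplicateᵇ _==_ (filter (λ p → Bool.T? (isRPal p)) (factorsList w))

sameOrbit : Word → Word → Bool
sameOrbit p q = (p == q) ∨ (Rev p == q) ∨ (Ant p == q) ∨ (Exch p == q)

-- Pal^H(w): one representative per H-orbit of factors that are R- or E-palindromes
PalH : Word → List Word
PalH w = deduplicateᵇ sameOrbit
           (filter (λ p → Bool.T? (isRPal p ∨ isEPal p)) (factorsList w))

DR : Word → ℕ
DR w = suc (length w) ∸ length (PalR w)

DH : Word → ℕ
DH w = suc (length w) ∸ length (PalH w)

-- D^X(u) = 0  (sup over factors is 0)
RRich : InfWord → Set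
RRich u = ∀ w → w ∈L u → DR w ≡ 0

HRich : InfWord → Set
HRich u = ∀ w → w ∈L u → DH w ≡ 0

-- D^X(u) < ∞ (the supremum over factors is finite)
AlmostRRich : InfWord → Set
AlmostRRich u = ∃ λ B → ∀ w → w ∈L u → DR w ≤ B

AlmostHRich : InfWord → Set
AlmostHRich u = ∃ λ B → ∀ w → w ∈L u → DH w ≤ B

-- S(u₀u₁u₂⋯) = v₁v₂⋯ with v_i = u_{i-1} + u_i mod 2 (re-indexed from 0)
S : InfWord → InfWord
S u i = u i xor u (suc i)

-- Write Sʷ for S on finite words: Sʷ (w₀⋯wₙ) = (w₀+w₁)⋯(wₙ₋₁+wₙ).  Sʷ commutes with reversal,
-- is invariant under exchanging the letters, and identifies two words of equal length
-- exactly when they are equal or exchanged.  Hence p is an R- or E-palindrome iff Sʷ p is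
-- an R-palindrome, the H-orbit of such a p is {p, p̄}, and p ↦ Sʷ p is a bijection from the
-- H-orbits of nonempty H-palindromic factors of w onto the R-palindromic factors of Sʷ w
-- (these lift to factors of w).  The orbit of ε adds one, so #Pal^H(w) = #Pal^R(Sʷ w) + 1,
-- and as |Sʷ w| = |w| - 1 this says D^H(w) = D^R(Sʷ w).  The factors of S(u) are exactly
-- the images under Sʷ of the factors of u, so both equivalences follow.
module Submission where

open import Defs
open import Level using (Level)
open import Data.Bool using (Bool; true; false; not; _xor_; _∨_; T)
import Data.Bool as Bool
open import Data.Bool.Properties
  using (T-∨; xor-comm; xor-assoc; xor-same; not-involutive; ¬-not)
open import Data.List
  using (List; []; _∷_; _∷ʳ_; length; reverse; map; filter; deduplicate; inits; tails; concatMap)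
open import Data.List.Properties
  using (≡-dec; length-map; unfold-reverse; length-reverse; reverse-map; reverse-involutive)
open import Data.List.Membership.Propositional using (_∈_)
open import Data.List.Membership.Propositional.Properties
  using (∈-deduplicate⁻; deduplicate-∈⇔; ∈-map⁺; ∈-map⁻; ∈-++⁺ˡ; ∈-++⁺ʳ; ∈-++⁻; ∈-filter⁺; ∈-filter⁻)
open import Data.List.Membership.Propositional.Properties.WithK using (unique∧set⇒bag)
open import Data.List.Relation.Unary.Any using (here; there)
import Data.List.Relation.Unary.All as All
import Data.List.Relation.Unary.All.Properties as All
open import Data.List.Relation.Unary.AllPairs using (_∷_)
open import Data.List.Relation.Unary.Unique.Propositional using (Unique)
import Data.List.Relation.Unary.Unique.Propositional.Properties as Unique
open import Data.List.Relation.Unary.Unique.DecPropositional.Properties using (deduplicate-!)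
open import Data.List.Relation.Binary.BagAndSetEquality using (∼bag⇒↭; ∷-cong; map-cong)
open import Data.List.Relation.Binary.Permutation.Propositional.Properties using (↭-length)
open import Data.List.Relation.Binary.Prefix.Heterogeneous using (Prefix; []; _∷_)
open import Data.List.Relation.Binary.Infix.Heterogeneous using (Infix; here; there)
open import Data.Maybe using (Maybe; just; nothing)
open import Data.Maybe.Properties using (just-injective)
import Data.Maybe.Properties as Maybe
open import Data.Nat using (ℕ; suc; _∸_; _≤_)
open import Data.Product using (_×_; _,_; proj₂; ∃-syntax)
open import Data.Sum using (_⊎_; inj₁; inj₂)
import Data.Sum as Sum
open import Data.Sum.Function.Propositional using (_⊎-⇔_)
open import Function using (_∘′_)
open import Function.Bundles using (_⇔_; mk⇔; Equivalence)
import Function.Properties.Equivalence as ⇔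
open import Relation.Nullary using (does; ¬?; yes; no)
open import Relation.Nullary.Decidable using (toWitness; fromWitness; does-⇔; isYes≗does)
open import Relation.Unary using (Pred; Decidable)
open import Relation.Binary using (Rel)
import Relation.Binary as Binary
open import Relation.Binary.Definitions using (DecidableEquality)
open import Relation.Binary.PropositionalEquality

private
  variable
    a b p r : Level
    A : Set a
    B : Set b

filter-cong : {P Q : Pred A p} (P? : Decidable P) (Q? : Decidable Q) (xs : List A) →
              (∀ {x} → x ∈ xs → does (P? x) ≡ does (Q? x)) → filter P? xs ≡ filter Q? xs
filter-cong P? Q? []       agree = refl
filter-cong P? Q? (x ∷ xs) agree with does (P? x) | does (Q? x) | agree (here refl)
... | true  | true  | refl = cong (x ∷_) (filter-cong P? Q? xs (λ m → agree (there m)))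
... | false | false | refl = filter-cong P? Q? xs (λ m → agree (there m))

deduplicate-cong : {R Q : Rel A r} (R? : Binary.Decidable R) (Q? : Binary.Decidable Q) (xs : List A) →
                   (∀ {x y} → x ∈ xs → y ∈ xs → does (R? x y) ≡ does (Q? x y)) →
                   deduplicate R? xs ≡ deduplicate Q? xs
deduplicate-cong R? Q? []       agree = refl
deduplicate-cong R? Q? (x ∷ xs) agree
  rewrite deduplicate-cong R? Q? xs (λ m n → agree (there m) (there n)) =
  cong (x ∷_) (filter-cong _ _ (deduplicate Q? xs)
    (λ m → cong not (agree (here refl) (there (∈-deduplicate⁻ Q? xs m)))))

map-filter : (f : A → B) {P : Pred B p} (P? : Decidable P) (xs : List A) →
             map f (filter (λ x → P? (f x)) xs) ≡ filter P? (map f xs)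
map-filter f P? []       = refl
map-filter f P? (x ∷ xs) with does (P? (f x))
... | true  = cong (f x ∷_) (map-filter f P? xs)
... | false = map-filter f P? xs

map-deduplicate : (f : A → B) (_≟_ : DecidableEquality B) (xs : List A) →
                  map f (deduplicate (λ x y → f x ≟ f y) xs) ≡ deduplicate _≟_ (map f xs)
map-deduplicate f _≟_ []       = refl
map-deduplicate f _≟_ (x ∷ xs) = cong (f x ∷_) (begin
  map f (filter (λ y → ¬? (f x ≟ f y)) (deduplicate (λ y z → f y ≟ f z) xs))
    ≡⟨ map-filter f (λ z → ¬? (f x ≟ z)) (deduplicate (λ y z → f y ≟ f z) xs) ⟩
  filter (λ z → ¬? (f x ≟ z)) (map f (deduplicate (λ y z → f y ≟ f z) xs))
    ≡⟨ cong (filter (λ z → ¬? (f x ≟ z))) (map-deduplicate f _≟_ xs) ⟩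
  filter (λ z → ¬? (f x ≟ z)) (deduplicate _≟_ (map f xs)) ∎)
  where open ≡-Reasoning

length-unique-cong : {xs ys : List A} → Unique xs → Unique ys →
                     (∀ {z} → z ∈ xs ⇔ z ∈ ys) → length xs ≡ length ys
length-unique-cong xs! ys! xs≈ys = ↭-length (∼bag⇒↭ (unique∧set⇒bag xs! ys! xs≈ys))

length-deduplicate-cong : (_≟_ : DecidableEquality A) {xs ys : List A} →
                          (∀ {z} → z ∈ xs ⇔ z ∈ ys) →
                          length (deduplicate _≟_ xs) ≡ length (deduplicate _≟_ ys)
length-deduplicate-cong _≟_ {xs} {ys} xs≈ys =
  length-unique-cong (deduplicate-! _≟_ xs) (deduplicate-! _≟_ ys)
    (⇔.trans (⇔.sym (deduplicate-∈⇔ _≟_)) (⇔.trans xs≈ys (deduplicate-∈⇔ _≟_)))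

length-deduplicate-nothing∷just : (_≟_ : DecidableEquality A) (xs : List A) →
  length (deduplicate (Maybe.≡-dec _≟_) (nothing ∷ map just xs)) ≡ suc (length (deduplicate _≟_ xs))
length-deduplicate-nothing∷just _≟_ xs = begin
  length (deduplicate (Maybe.≡-dec _≟_) (nothing ∷ map just xs))
    ≡⟨ length-unique-cong (deduplicate-! (Maybe.≡-dec _≟_) (nothing ∷ map just xs)) unique
         (⇔.trans (⇔.sym (deduplicate-∈⇔ (Maybe.≡-dec _≟_) {nothing ∷ map just xs}))
                  (∷-cong refl (map-cong (λ _ → refl) (deduplicate-∈⇔ _≟_)))) ⟩
  length (nothing ∷ map just (deduplicate _≟_ xs))
    ≡⟨ cong suc (length-map just (deduplicate _≟_ xs)) ⟩
  suc (length (deduplicate _≟_ xs)) ∎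
  where
  open ≡-Reasoning
  unique : Unique (nothing ∷ map just (deduplicate _≟_ xs))
  unique = All.map⁺ (All.universal (λ _ ()) _) ∷ Unique.map⁺ just-injective (deduplicate-! _≟_ xs)

∈-inits⇔ : {z t : List A} → z ∈ inits t ⇔ Prefix _≡_ z t
∈-inits⇔ = mk⇔ to from
  where
  to : ∀ {z t} → z ∈ inits t → Prefix _≡_ z t
  to {t = []}    (here refl) = []
  to {t = x ∷ t} (here refl) = []
  to {t = x ∷ t} (there m) with ∈-map⁻ (x ∷_) m
  ... | z , m′ , refl = refl ∷ to m′
  from : ∀ {z t} → Prefix _≡_ z t → z ∈ inits t
  from {t = []}    []           = here refl
  from {t = x ∷ t} []           = here refl
  from             (refl ∷ pre) = there (∈-map⁺ (_ ∷_) (from pre))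

∈-concatMap-inits-tails⇔ : {z w : List A} → z ∈ concatMap inits (tails w) ⇔ Infix _≡_ z w
∈-concatMap-inits-tails⇔ = mk⇔ to from
  where
  to : ∀ {z w} → z ∈ concatMap inits (tails w) → Infix _≡_ z w
  to {w = []}    (here refl) = here []
  to {w = x ∷ w} m with ∈-++⁻ (inits (x ∷ w)) m
  ... | inj₁ m′ = here (Equivalence.to ∈-inits⇔ m′)
  ... | inj₂ m′ = there (to m′)
  from : ∀ {z w} → Infix _≡_ z w → z ∈ concatMap inits (tails w)
  from {w = []}    (here [])   = here refl
  from {w = x ∷ w} (here pre)  = ∈-++⁺ˡ (Equivalence.from ∈-inits⇔ pre)
  from {w = x ∷ w} (there inf) = ∈-++⁺ʳ (inits (x ∷ w)) (from inf)

δ : Bool → Word → Word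
δ x []      = []
δ x (y ∷ w) = (x xor y) ∷ δ y w

Sʷ : Word → Word
Sʷ []      = []
Sʷ (x ∷ w) = δ x w

length-δ : ∀ x w → length (δ x w) ≡ length w
length-δ x []      = refl
length-δ x (y ∷ w) = cong suc (length-δ y w)

δ-map-not : ∀ x w → δ (not x) (map not w) ≡ δ x w
δ-map-not x []      = refl
δ-map-not x (y ∷ w) = cong₂ _∷_ (xor-not-not x y) (δ-map-not y w)
  where
  xor-not-not : ∀ x y → not x xor not y ≡ x xor y
  xor-not-not true  y = refl
  xor-not-not false y = not-involutive y

Sʷ-map-not : ∀ w → Sʷ (map not w) ≡ Sʷ w
Sʷ-map-not []      = refl
Sʷ-map-not (x ∷ w) = δ-map-not x w

Sʷ-∷ʳ : ∀ v y z → Sʷ (v ∷ʳ y ∷ʳ z) ≡ Sʷ (v ∷ʳ y) ∷ʳ (y xor z)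
Sʷ-∷ʳ []      y z = refl
Sʷ-∷ʳ (x ∷ v) y z = δ-∷ʳ x v
  where
  δ-∷ʳ : ∀ x v → δ x (v ∷ʳ y ∷ʳ z) ≡ δ x (v ∷ʳ y) ∷ʳ (y xor z)
  δ-∷ʳ x []      = refl
  δ-∷ʳ x (u ∷ v) = cong ((x xor u) ∷_) (δ-∷ʳ u v)

Sʷ-reverse : ∀ w → Sʷ (reverse w) ≡ reverse (Sʷ w)
Sʷ-reverse []          = refl
Sʷ-reverse (x ∷ [])    = refl
Sʷ-reverse (x ∷ y ∷ w) = begin
  Sʷ (reverse (x ∷ y ∷ w))                ≡⟨ cong Sʷ (unfold-reverse x (y ∷ w)) ⟩
  Sʷ (reverse (y ∷ w) ∷ʳ x)               ≡⟨ cong (λ v → Sʷ (v ∷ʳ x)) (unfold-reverse y w) ⟩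
  Sʷ (reverse w ∷ʳ y ∷ʳ x)                ≡⟨ Sʷ-∷ʳ (reverse w) y x ⟩
  Sʷ (reverse w ∷ʳ y) ∷ʳ (y xor x)        ≡⟨ cong (λ v → Sʷ v ∷ʳ (y xor x)) (unfold-reverse y w) ⟨
  Sʷ (reverse (y ∷ w)) ∷ʳ (y xor x)       ≡⟨ cong₂ _∷ʳ_ (Sʷ-reverse (y ∷ w)) (xor-comm y x) ⟩
  reverse (Sʷ (y ∷ w)) ∷ʳ (x xor y)       ≡⟨ unfold-reverse (x xor y) (Sʷ (y ∷ w)) ⟨
  reverse (Sʷ (x ∷ y ∷ w))                ∎
  where open ≡-Reasoning

Sʷ-Ant : ∀ w → Sʷ (Ant w) ≡ reverse (Sʷ w)
Sʷ-Ant w = trans (Sʷ-reverse (map not w)) (cong reverse (Sʷ-map-not w))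

integrate : Bool → Word → Word
integrate x []       = []
integrate x (d ∷ ds) = (x xor d) ∷ integrate (x xor d) ds

xor-cancelˡ : ∀ x y → x xor (x xor y) ≡ y
xor-cancelˡ x y = trans (sym (xor-assoc x x y)) (cong (_xor y) (xor-same x))

integrate-δ : ∀ x w → integrate x (δ x w) ≡ w
integrate-δ x []      = refl
integrate-δ x (y ∷ w) rewrite xor-cancelˡ x y = cong (y ∷_) (integrate-δ y w)

δ-injectiveʳ : ∀ x {v w} → δ x v ≡ δ x w → v ≡ w
δ-injectiveʳ x {v} {w} eq = begin
  v                   ≡⟨ integrate-δ x v ⟨
  integrate x (δ x v) ≡⟨ cong (integrate x) eq ⟩
  integrate x (δ x w) ≡⟨ integrate-δ x w ⟩
  w                   ∎
  where open ≡-Reasoning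

Sʷ-injective : ∀ v w → length v ≡ length w → Sʷ v ≡ Sʷ w → v ≡ w ⊎ Exch v ≡ w
Sʷ-injective []      []      _ _  = inj₁ refl
Sʷ-injective (x ∷ v) (y ∷ w) _ eq with x Bool.≟ y
... | yes refl = inj₁ (cong (x ∷_) (δ-injectiveʳ x eq))
... | no x≢y rewrite ¬-not (λ y≡x → x≢y (sym y≡x)) =
  inj₂ (cong (not x ∷_) (δ-injectiveʳ (not x) (trans (δ-map-not x v) eq)))

IsHPal : Word → Set
IsHPal p = Rev p ≡ p ⊎ Ant p ≡ p

Ant≡Exch∘Rev : ∀ p → Ant p ≡ Exch (Rev p)
Ant≡Exch∘Rev p = sym (reverse-map not p)

HPal-orbit : ∀ {p} → IsHPal p → ∀ h → act h p ≡ p ⊎ act h p ≡ Exch p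
HPal-orbit     _         hid = inj₁ refl
HPal-orbit     _         hER = inj₂ refl
HPal-orbit     (inj₁ pR) hR  = inj₁ pR
HPal-orbit {p} (inj₁ pR) hE  = inj₂ (trans (Ant≡Exch∘Rev p) (cong Exch pR))
HPal-orbit     (inj₂ pE) hE  = inj₁ pE
HPal-orbit {p} (inj₂ pE) hR  = inj₂ (begin
  Rev p        ≡⟨ cong Rev pE ⟨
  Rev (Ant p)  ≡⟨ reverse-involutive (Exch p) ⟩
  Exch p       ∎)
  where open ≡-Reasoning

HPal⇔RPal-Sʷ : ∀ {p} → IsHPal p ⇔ Rev (Sʷ p) ≡ Sʷ p
HPal⇔RPal-Sʷ {p} = mk⇔ to from
  where
  to : IsHPal p → Rev (Sʷ p) ≡ Sʷ p
  to (inj₁ pR) = trans (sym (Sʷ-reverse p)) (cong Sʷ pR)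
  to (inj₂ pE) = trans (sym (Sʷ-Ant p)) (cong Sʷ pE)
  from : Rev (Sʷ p) ≡ Sʷ p → IsHPal p
  from SpR with Sʷ-injective (Rev p) p (length-reverse p) (trans (Sʷ-reverse p) SpR)
  ... | inj₁ pR = inj₁ pR
  ... | inj₂ pE = inj₂ (trans (Ant≡Exch∘Rev p) pE)

-- nothing codes the orbit of ε, which Sʷ alone would confuse with the orbits of the letters.
orbitCode : Word → Maybe Word
orbitCode []      = nothing
orbitCode (x ∷ w) = just (δ x w)

orbitCode-injective : ∀ p q → orbitCode p ≡ orbitCode q → p ≡ q ⊎ Exch p ≡ q
orbitCode-injective []      []      _  = inj₁ refl
orbitCode-injective (x ∷ v) (y ∷ w) eq = Sʷ-injective (x ∷ v) (y ∷ w) (cong suc same-length) δ-eq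
  where
  δ-eq : δ x v ≡ δ y w
  δ-eq = just-injective eq
  same-length : length v ≡ length w
  same-length = trans (sym (length-δ x v)) (trans (cong length δ-eq) (length-δ y w))

orbitCode-Exch : ∀ p → orbitCode (Exch p) ≡ orbitCode p
orbitCode-Exch []      = refl
orbitCode-Exch (x ∷ v) = cong just (δ-map-not x v)

orbitCode≡⇔ : ∀ {p q} → orbitCode p ≡ orbitCode q ⇔ (p ≡ q ⊎ Exch p ≡ q)
orbitCode≡⇔ {p} {q} = mk⇔ (orbitCode-injective p q) λ where
  (inj₁ refl) → refl
  (inj₂ refl) → sym (orbitCode-Exch p)

T-==⇔ : ∀ {v w} → T (v == w) ⇔ v ≡ w
T-==⇔ = mk⇔ toWitness fromWitness

T-sameOrbit⇔ : ∀ {p q} → T (sameOrbit p q) ⇔ (p ≡ q ⊎ Rev p ≡ q ⊎ Ant p ≡ q ⊎ Exch p ≡ q)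
T-sameOrbit⇔ {p} {q} =
  ⇔.trans (T-∨ {p == q})    (T-==⇔ ⊎-⇔
  ⇔.trans (T-∨ {Rev p == q}) (T-==⇔ ⊎-⇔
  ⇔.trans (T-∨ {Ant p == q}) (T-==⇔ {Ant p} ⊎-⇔ T-==⇔ {Exch p})))

HPal-sameOrbit⇔ : ∀ {p q} → IsHPal p → T (sameOrbit p q) ⇔ orbitCode p ≡ orbitCode q
HPal-sameOrbit⇔ {p} {q} pH = ⇔.trans T-sameOrbit⇔ (⇔.trans (mk⇔ to from) (⇔.sym orbitCode≡⇔))
  where
  image : ∀ h → act h p ≡ q → p ≡ q ⊎ Exch p ≡ q
  image h refl = Sum.map sym sym (HPal-orbit pH h)
  to : p ≡ q ⊎ Rev p ≡ q ⊎ Ant p ≡ q ⊎ Exch p ≡ q → p ≡ q ⊎ Exch p ≡ q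
  to (inj₁ e)                = inj₁ e
  to (inj₂ (inj₁ e))         = image hR e
  to (inj₂ (inj₂ (inj₁ e)))  = image hE e
  to (inj₂ (inj₂ (inj₂ e)))  = inj₂ e
  from : p ≡ q ⊎ Exch p ≡ q → p ≡ q ⊎ Rev p ≡ q ⊎ Ant p ≡ q ⊎ Exch p ≡ q
  from = Sum.map₂ (inj₂ ∘′ inj₂)

δ-prefix : ∀ x {v w} → Prefix _≡_ v w → Prefix _≡_ (δ x v) (δ x w)
δ-prefix x []           = []
δ-prefix x (refl ∷ pre) = refl ∷ δ-prefix _ pre

Sʷ-infix : ∀ {v w} → Infix _≡_ v w → Infix _≡_ (Sʷ v) (Sʷ w)
Sʷ-infix (here [])                   = here []
Sʷ-infix (here (refl ∷ pre))         = here (δ-prefix _ pre)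
Sʷ-infix {w = _ ∷ []}    (there inf) = Sʷ-infix inf
Sʷ-infix {w = _ ∷ _ ∷ _} (there inf) = there (Sʷ-infix inf)

δ-prefix⁻ : ∀ y {s q} → Prefix _≡_ q (δ y s) → ∃[ s′ ] Prefix _≡_ s′ s × δ y s′ ≡ q
δ-prefix⁻ y {[]}    []           = [] , [] , refl
δ-prefix⁻ y {_ ∷ _} []           = [] , [] , refl
δ-prefix⁻ y {_ ∷ _} (refl ∷ pre) with δ-prefix⁻ _ pre
... | s′ , pre′ , refl = _ ∷ s′ , refl ∷ pre′ , refl

δ-infix⁻ : ∀ x {r q} → Infix _≡_ q (δ x r) → ∃[ y ] ∃[ s ] Infix _≡_ (y ∷ s) (x ∷ r) × δ y s ≡ q
δ-infix⁻ x {[]}    (here [])   = x , [] , here (refl ∷ []) , refl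
δ-infix⁻ x {_ ∷ _} (here pre)  with δ-prefix⁻ x pre
... | s , pre′ , eq = x , s , here (refl ∷ pre′) , eq
δ-infix⁻ x {_ ∷ _} (there inf) with δ-infix⁻ _ inf
... | y , s , inf′ , eq = y , s , there inf′ , eq

HPalFactors : Word → List Word
HPalFactors w = filter (λ p → Bool.T? (isRPal p ∨ isEPal p)) (factorsList w)

RPalFactors : Word → List Word
RPalFactors w = filter (λ p → Bool.T? (isRPal p)) (factorsList w)

∈-HPalFactors⇔ : ∀ w {p} → p ∈ HPalFactors w ⇔ (Infix _≡_ p w × IsHPal p)
∈-HPalFactors⇔ w {p} = mk⇔
  (λ m → let m′ , t = ∈-filter⁻ P? m in Equivalence.to ∈-concatMap-inits-tails⇔ m′ , Equivalence.to T-isHPal⇔ t)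
  (λ (inf , pH) → ∈-filter⁺ P? (Equivalence.from ∈-concatMap-inits-tails⇔ inf) (Equivalence.from T-isHPal⇔ pH))
  where
  P? = λ p → Bool.T? (isRPal p ∨ isEPal p)
  T-isHPal⇔ : T (isRPal p ∨ isEPal p) ⇔ IsHPal p
  T-isHPal⇔ = ⇔.trans (T-∨ {isRPal p}) (T-==⇔ ⊎-⇔ T-==⇔ {Ant p})

∈-RPalFactors⇔ : ∀ w {q} → q ∈ RPalFactors w ⇔ (Infix _≡_ q w × Rev q ≡ q)
∈-RPalFactors⇔ w {q} = mk⇔
  (λ m → let m′ , t = ∈-filter⁻ P? m in Equivalence.to ∈-concatMap-inits-tails⇔ m′ , Equivalence.to T-==⇔ t)
  (λ (inf , qR) → ∈-filter⁺ P? (Equivalence.from ∈-concatMap-inits-tails⇔ inf) (Equivalence.from T-==⇔ qR))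
  where
  P? = λ p → Bool.T? (isRPal p)

orbitCodes-HPalFactors : ∀ x r {c} →
  c ∈ map orbitCode (HPalFactors (x ∷ r)) ⇔ c ∈ nothing ∷ map just (RPalFactors (δ x r))
orbitCodes-HPalFactors x r = mk⇔ to from
  where
  to : ∀ {c} → c ∈ map orbitCode (HPalFactors (x ∷ r)) → c ∈ nothing ∷ map just (RPalFactors (δ x r))
  to m with ∈-map⁻ orbitCode m
  ... | [] , _ , refl = here refl
  ... | y ∷ s , m′ , refl =
    let inf , pH = Equivalence.to (∈-HPalFactors⇔ (x ∷ r)) m′ in
    there (∈-map⁺ just (Equivalence.from (∈-RPalFactors⇔ (δ x r))
      (Sʷ-infix inf , Equivalence.to HPal⇔RPal-Sʷ pH)))
  from : ∀ {c} → c ∈ nothing ∷ map just (RPalFactors (δ x r)) → c ∈ map orbitCode (HPalFactors (x ∷ r))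
  from (here refl) = ∈-map⁺ orbitCode (Equivalence.from (∈-HPalFactors⇔ (x ∷ r)) (here [] , inj₁ refl))
  from (there m) with ∈-map⁻ just m
  ... | q , m′ , refl with Equivalence.to (∈-RPalFactors⇔ (δ x r)) m′
  ... | inf , qR with δ-infix⁻ x inf
  ... | y , s , inf′ , refl = ∈-map⁺ orbitCode (Equivalence.from (∈-HPalFactors⇔ (x ∷ r))
      (inf′ , Equivalence.from HPal⇔RPal-Sʷ qR))

length-PalH : ∀ x r → length (PalH (x ∷ r)) ≡ suc (length (PalR (δ x r)))
length-PalH x r = begin
  length (PalH (x ∷ r))
    ≡⟨ cong length (deduplicate-cong _ sameCode? L orbit-agrees) ⟩
  length (deduplicate sameCode? L)
    ≡⟨ length-map orbitCode (deduplicate sameCode? L) ⟨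
  length (map orbitCode (deduplicate sameCode? L))
    ≡⟨ cong length (map-deduplicate orbitCode _≟ᶜ_ L) ⟩
  length (deduplicate _≟ᶜ_ (map orbitCode L))
    ≡⟨ length-deduplicate-cong _≟ᶜ_ (orbitCodes-HPalFactors x r) ⟩
  length (deduplicate _≟ᶜ_ (nothing ∷ map just (RPalFactors (δ x r))))
    ≡⟨ length-deduplicate-nothing∷just _≟ʷ_ (RPalFactors (δ x r)) ⟩
  suc (length (deduplicate _≟ʷ_ (RPalFactors (δ x r))))
    ≡⟨ cong (suc ∘′ length) (deduplicate-cong _≟ʷ_ (λ p q → Bool.T? (p == q)) (RPalFactors (δ x r))
         (λ {p} {q} _ _ → sym (isYes≗does (p ≟ʷ q)))) ⟩
  suc (length (PalR (δ x r))) ∎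
  where
  open ≡-Reasoning
  L = HPalFactors (x ∷ r)
  _≟ʷ_ : DecidableEquality Word
  _≟ʷ_ = ≡-dec Bool._≟_
  _≟ᶜ_ : DecidableEquality (Maybe Word)
  _≟ᶜ_ = Maybe.≡-dec _≟ʷ_
  sameCode? : Binary.Decidable (λ p q → orbitCode p ≡ orbitCode q)
  sameCode? p q = orbitCode p ≟ᶜ orbitCode q
  orbit-agrees : ∀ {p q} → p ∈ L → q ∈ L → sameOrbit p q ≡ does (sameCode? p q)
  orbit-agrees {p} {q} p∈L _ =
    does-⇔ (HPal-sameOrbit⇔ (proj₂ (Equivalence.to (∈-HPalFactors⇔ (x ∷ r)) p∈L)))
      (Bool.T? (sameOrbit p q)) (sameCode? p q)

DH≡DR∘Sʷ : ∀ w → DH w ≡ DR (Sʷ w)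
DH≡DR∘Sʷ []      = refl
DH≡DR∘Sʷ (x ∷ r) = begin
  suc (suc (length r)) ∸ length (PalH (x ∷ r))  ≡⟨ cong (suc (suc (length r)) ∸_) (length-PalH x r) ⟩
  suc (length r) ∸ length (PalR (δ x r))        ≡⟨ cong (λ n → suc n ∸ length (PalR (δ x r))) (length-δ x r) ⟨
  DR (δ x r)                                    ∎
  where open ≡-Reasoning

length-window : ∀ u i n → length (window u i n) ≡ n
length-window u i 0       = refl
length-window u i (suc n) = cong suc (length-window u (suc i) n)

Sʷ-window : ∀ u i n → Sʷ (window u i (suc n)) ≡ window (S u) i n
Sʷ-window u i 0       = refl
Sʷ-window u i (suc n) = cong (_ ∷_) (Sʷ-window u (suc i) n)

Sʷ-∈L : ∀ {u v} → v ∈L u → Sʷ v ∈L S u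
Sʷ-∈L {v = []}    _       = 0 , refl
Sʷ-∈L {u} {x ∷ r} (i , e) = i , (begin
  window (S u) i (length (δ x r))  ≡⟨ cong (window (S u) i) (length-δ x r) ⟩
  window (S u) i (length r)        ≡⟨ Sʷ-window u i (length r) ⟨
  Sʷ (window u i (suc (length r))) ≡⟨ cong Sʷ e ⟩
  Sʷ (x ∷ r)                       ∎)
  where open ≡-Reasoning

∈L-S⁻ : ∀ {u w} → w ∈L S u → ∃[ v ] v ∈L u × Sʷ v ≡ w
∈L-S⁻ {u} {w} (i , e) =
  window u i (suc (length w)) ,
  (i , cong (window u i ∘′ suc) (length-window u (suc i) (length w))) ,
  trans (Sʷ-window u i (length w)) e

factors-DH⇔factors-DR : ∀ u (P : ℕ → Set) →
  (∀ v → v ∈L u → P (DH v)) ⇔ (∀ w → w ∈L S u → P (DR w))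
factors-DH⇔factors-DR u P = mk⇔ to from
  where
  to : (∀ v → v ∈L u → P (DH v)) → ∀ w → w ∈L S u → P (DR w)
  to h w w∈ with ∈L-S⁻ w∈
  ... | v , v∈ , refl = subst P (DH≡DR∘Sʷ v) (h v v∈)
  from : (∀ w → w ∈L S u → P (DR w)) → ∀ v → v ∈L u → P (DH v)
  from h v v∈ = subst P (sym (DH≡DR∘Sʷ v)) (h (Sʷ v) (Sʷ-∈L v∈))

mainTheorem1 : (u : InfWord) → ClosedUnderH u →
    (HRich u ⇔ RRich (S u)) × (AlmostHRich u ⇔ AlmostRRich (S u))
mainTheorem1 u _ = factors-DH⇔factors-DR u (_≡ 0) , mk⇔
  (λ (B , h) → B , Equivalence.to   (factors-DH⇔factors-DR u (_≤ B)) h)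
  (λ (B , h) → B , Equivalence.from (factors-DH⇔factors-DR u (_≤ B)) h)
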